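{- Let $U$ be an infinite subset of $\mathbb Z$. Then the ring $LIP(U)$ contains an infinite strictly increasing chain of principal ideals.
   Context: For an infinite $U\subseteq\mathbb Z$, a function $f\colon U\to\mathbb Z$ is LIP (locally integer polynomial) on $U$ if for every finite $X\subseteq U$ there is $p\in\mathbb Z[x]$ with $p(x)=f(x)$ for all $x\in X$. $LIP(U)$ denotes the ring of all LIP functions on $U$ under pointwise addition and multiplication. -}

module Defs where

open import Data.Integer using (ℤ; _+_; _*_; 0ℤ)
open import Data.List using (List; []; _∷_)
open import Data.List.Relation.Unary.All using (All)
open import Data.List.Membership.Propositional using (_∉_)
open import Data.Product using (Σ; ∃; _×_; _,_; proj₁)
open import Data.Nat using (ℕ; suc)
open import Relation.Binary.PropositionalEquality using (_≡_)
open import Relation.Nullary using (¬_)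

Subset : Set₁
Subset = ℤ → Set

-- U is infinite: no finite list exhausts it (constructive form of "not finite").
Infinite : Subset → Set
Infinite U = (xs : List ℤ) → ∃ λ x → U x × x ∉ xs

El : Subset → Set
El U = Σ ℤ U

-- Integer polynomials as coefficient lists a₀ ∷ a₁ ∷ … (constant term first).
Poly : Set
Poly = List ℤ

eval : Poly → ℤ → ℤ
eval []       x = 0ℤ
eval (a ∷ as) x = a + x * eval as x

IsLIP : (U : Subset) → (El U → ℤ) → Set
IsLIP U f = (X : List (El U)) → ∃ λ (p : Poly) → All (λ u → eval p (proj₁ u) ≡ f u) X

record LIP (U : Subset) : Set where
  constructor lip
  field
    fun   : El U → ℤ
    isLIP : IsLIP U fun
open LIP public

_≈_ : ∀ {U} → LIP U → LIP U → Set
_≈_ {U} f g = (u : El U) → fun f u ≡ fun g u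

_·_ : ∀ {U} → LIP U → LIP U → El U → ℤ
(h · g) u = fun h u * fun g u

_∈⟨_⟩ : ∀ {U} → LIP U → LIP U → Set
_∈⟨_⟩ {U} a g = ∃ λ (h : LIP U) → (u : El U) → fun a u ≡ (h · g) u

_⊆⟨⟩_ : ∀ {U} → LIP U → LIP U → Set
_⊆⟨⟩_ {U} g g' = (a : LIP U) → a ∈⟨ g ⟩ → a ∈⟨ g' ⟩

_⊂⟨⟩_ : ∀ {U} → LIP U → LIP U → Set
g ⊂⟨⟩ g' = (g ⊆⟨⟩ g') × ¬ (g' ⊆⟨⟩ g)

StrictlyIncreasingPrincipalChain : (U : Subset) → (ℕ → LIP U) → Set
StrictlyIncreasingPrincipalChain U g = (n : ℕ) → g n ⊂⟨⟩ g (suc n)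

-- Let Zₘ(x) = ∏_{|j| ≤ m} (x − j) and hₘ = 1 + Zₘ².  Then hₘ is an integer polynomial, never
-- zero, equal to 1 on [−m, m], and of absolute value 1 only there.  Hence gₙ = ∏_{m ≥ n} hₘ is a
-- well-defined function ℤ → ℤ (at x only the factors with m < |x| differ from 1) which agrees with
-- a finite product of the hₘ on every bounded set, so it is LIP on every U.  Since gₙ = hₙ gₙ₊₁,
-- (gₙ) ⊆ (gₙ₊₁); and (gₙ₊₁) ⊆ (gₙ) would, after cancelling the nowhere-zero gₙ₊₁, make hₙ a unit of
-- LIP(U), i.e. |hₙ| = 1 on U, forcing U ⊆ [−n, n].
module Submission where

open import Defs
open import Data.Integer using (ℤ; +_; +[1+_]; -[1+_]; 0ℤ; 1ℤ; ∣_∣; _+_; _*_; _-_; -_; ≢-nonZero)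
open import Data.Integer.Properties
  using (+-identityˡ; +-identityʳ; +-inverseʳ; *-identityˡ; *-zeroˡ; *-zeroʳ; *-assoc; *-cancelʳ-≡;
         abs-*; i*j≡0⇒i≡0∨j≡0; i-j≡0⇒i≡j)
open import Data.Integer.Solver using (module +-*-Solver)
open import Data.List using (List; []; _∷_; map)
open import Data.List.Membership.Propositional using (_∈_)
open import Data.List.Relation.Unary.All as All using (All; []; _∷_)
open import Data.List.Relation.Unary.Any using (here; there)
open import Data.Nat as ℕ using (ℕ; zero; suc; _≤_; _⊔_; s≤s)
import Data.Nat.Properties as ℕ
open import Data.Product using (∃; _,_; proj₁; proj₂)
open import Data.Sum using (inj₁; inj₂)
open import Relation.Binary.PropositionalEquality
open import Relation.Nullary using (¬_)

IsPolynomial : (ℤ → ℤ) → Set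
IsPolynomial f = ∃ λ (p : Poly) → ∀ x → eval p x ≡ f x

infixl 6 _+ᴾ_
infixl 7 _*ᴾ_ _·ᴾ_

_+ᴾ_ : Poly → Poly → Poly
[]       +ᴾ q        = q
(a ∷ p)  +ᴾ []       = a ∷ p
(a ∷ p)  +ᴾ (b ∷ q)  = a + b ∷ p +ᴾ q

_·ᴾ_ : ℤ → Poly → Poly
c ·ᴾ p = map (c *_) p

_*ᴾ_ : Poly → Poly → Poly
[]      *ᴾ q = []
(a ∷ p) *ᴾ q = a ·ᴾ q +ᴾ (0ℤ ∷ p *ᴾ q)

module _ where
  open +-*-Solver

  eval-+ᴾ : ∀ p q x → eval (p +ᴾ q) x ≡ eval p x + eval q x
  eval-+ᴾ []      q       x = sym (+-identityˡ _)
  eval-+ᴾ (a ∷ p) []      x = sym (+-identityʳ _)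
  eval-+ᴾ (a ∷ p) (b ∷ q) x rewrite eval-+ᴾ p q x =
    solve 5 (λ a b x P Q → (a :+ b) :+ x :* (P :+ Q) := (a :+ x :* P) :+ (b :+ x :* Q))
          refl a b x (eval p x) (eval q x)

  eval-·ᴾ : ∀ c p x → eval (c ·ᴾ p) x ≡ c * eval p x
  eval-·ᴾ c []      x = sym (*-zeroʳ c)
  eval-·ᴾ c (a ∷ p) x rewrite eval-·ᴾ c p x =
    solve 4 (λ c a x P → c :* a :+ x :* (c :* P) := c :* (a :+ x :* P)) refl c a x (eval p x)

  eval-*ᴾ : ∀ p q x → eval (p *ᴾ q) x ≡ eval p x * eval q x
  eval-*ᴾ []      q x = sym (*-zeroˡ (eval q x))
  eval-*ᴾ (a ∷ p) q x
    rewrite eval-+ᴾ (a ·ᴾ q) (0ℤ ∷ p *ᴾ q) x | eval-·ᴾ a q x | eval-*ᴾ p q x =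
    solve 4 (λ a x P Q → a :* Q :+ (con 0ℤ :+ x :* (P :* Q)) := (a :+ x :* P) :* Q)
          refl a x (eval p x) (eval q x)

const-isPolynomial : ∀ c → IsPolynomial (λ _ → c)
const-isPolynomial c = c ∷ [] , λ x → trans (cong (λ z → c + z) (*-zeroʳ x)) (+-identityʳ c)

+-isPolynomial : ∀ {f g} → IsPolynomial f → IsPolynomial g → IsPolynomial (λ x → f x + g x)
+-isPolynomial (p , p≡f) (q , q≡g) = p +ᴾ q , λ x → trans (eval-+ᴾ p q x) (cong₂ _+_ (p≡f x) (q≡g x))

*-isPolynomial : ∀ {f g} → IsPolynomial f → IsPolynomial g → IsPolynomial (λ x → f x * g x)
*-isPolynomial (p , p≡f) (q , q≡g) = p *ᴾ q , λ x → trans (eval-*ᴾ p q x) (cong₂ _*_ (p≡f x) (q≡g x))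

linear-isPolynomial : ∀ j → IsPolynomial (λ x → x - j)
linear-isPolynomial j = - j ∷ 1ℤ ∷ [] , λ x →
  solve 2 (λ x j → :- j :+ x :* (con 1ℤ :+ x :* con 0ℤ) := x :- j) refl x j
  where open +-*-Solver

module _ {U : Subset} where

  bound : (X : List (El U)) → ∃ λ K → All (λ u → ∣ proj₁ u ∣ ≤ K) X
  bound []      = 0 , []
  bound (u ∷ X) with bound X
  ... | K , X≤K = ∣ proj₁ u ∣ ⊔ K
                , ℕ.m≤m⊔n _ K ∷ All.map (λ ≤K → ℕ.≤-trans ≤K (ℕ.m≤n⊔m ∣ proj₁ u ∣ K)) X≤K

  boundedlyPolynomial⇒LIP : (f : ℤ → ℤ) →
    (∀ K → ∃ λ p → ∀ x → ∣ x ∣ ≤ K → eval p x ≡ f x) → LIP U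
  boundedlyPolynomial⇒LIP f approx = lip (λ u → f (proj₁ u)) λ X →
    let K , X≤K = bound X ; p , p≡f = approx K in
    p , All.map (λ {u} → p≡f (proj₁ u)) X≤K

  polynomial⇒LIP : ∀ {f} → IsPolynomial f → LIP U
  polynomial⇒LIP {f} (p , p≡f) = boundedlyPolynomial⇒LIP f (λ _ → p , λ x _ → p≡f x)

  1ᴸ : LIP U
  1ᴸ = polynomial⇒LIP (const-isPolynomial 1ℤ)

  _*ᴸ_ : LIP U → LIP U → LIP U
  f *ᴸ g = lip (f · g) λ X →
    let p , p≡f = isLIP f X ; q , q≡g = isLIP g X in
    p *ᴾ q , All.zipWith (λ {u} (p≡fu , q≡gu) → trans (eval-*ᴾ p q (proj₁ u)) (cong₂ _*_ p≡fu q≡gu))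
                         (p≡f , q≡g)

  ∈⟨⟩-refl : ∀ g → g ∈⟨ g ⟩
  ∈⟨⟩-refl g = 1ᴸ , λ u → sym (*-identityˡ (fun g u))

  ∈⟨⟩⇒⊆⟨⟩ : ∀ {g g'} → g ∈⟨ g' ⟩ → g ⊆⟨⟩ g'
  ∈⟨⟩⇒⊆⟨⟩ {g} {g'} (k , g≡kg') a (h , a≡hg) = h *ᴸ k , λ u → begin
    fun a u                        ≡⟨ a≡hg u ⟩
    fun h u * fun g u              ≡⟨ cong (fun h u *_) (g≡kg' u) ⟩
    fun h u * (fun k u * fun g' u) ≡⟨ *-assoc (fun h u) _ _ ⟨
    (fun h u * fun k u) * fun g' u ∎
    where open ≡-Reasoning

  ⊆⟨⟩⇒cofactor-unit : ∀ {g g' k} → (∀ u → fun g u ≡ (k · g') u) → (∀ u → fun g' u ≢ 0ℤ) →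
    g' ⊆⟨⟩ g → ∀ u → ∣ fun k u ∣ ≡ 1
  ⊆⟨⟩⇒cofactor-unit {g} {g'} {k} g≡kg' g'≢0 g'⊆g u with g'⊆g g' (∈⟨⟩-refl g')
  ... | h , g'≡hg = ℕ.m*n≡1⇒n≡1 ∣ fun h u ∣ ∣ fun k u ∣ (begin
    ∣ fun h u ∣ ℕ.* ∣ fun k u ∣ ≡⟨ abs-* (fun h u) (fun k u) ⟨
    ∣ fun h u * fun k u ∣       ≡⟨ cong ∣_∣ hk≡1 ⟨
    1                           ∎)
    where
    open ≡-Reasoning
    hk≡1 : 1ℤ ≡ fun h u * fun k u
    hk≡1 = *-cancelʳ-≡ _ _ (fun g' u) {{≢-nonZero (g'≢0 u)}} (begin
      1ℤ * fun g' u                  ≡⟨ *-identityˡ _ ⟩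
      fun g' u                       ≡⟨ g'≡hg u ⟩
      fun h u * fun g u              ≡⟨ cong (fun h u *_) (g≡kg' u) ⟩
      fun h u * (fun k u * fun g' u) ≡⟨ *-assoc (fun h u) _ _ ⟨
      fun h u * fun k u * fun g' u   ∎)

1+i*i≢0 : ∀ i → 1ℤ + i * i ≢ 0ℤ
1+i*i≢0 (+ 0)     ()
1+i*i≢0 +[1+ n ] ()
1+i*i≢0 -[1+ n ] ()

∣1+i*i∣≡1⇒i≡0 : ∀ i → ∣ 1ℤ + i * i ∣ ≡ 1 → i ≡ 0ℤ
∣1+i*i∣≡1⇒i≡0 (+ 0)     _ = refl
∣1+i*i∣≡1⇒i≡0 +[1+ n ] ()
∣1+i*i∣≡1⇒i≡0 -[1+ n ] ()

interval : ℕ → List ℤ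
interval zero    = 0ℤ ∷ []
interval (suc m) = + suc m ∷ -[1+ m ] ∷ interval m

∣x∣≤m⇒x∈interval : ∀ m x → ∣ x ∣ ≤ m → x ∈ interval m
∣x∣≤m⇒x∈interval zero    (+ 0)    _ = here refl
∣x∣≤m⇒x∈interval (suc m) (+ n)    n≤1+m with ℕ.m≤n⇒m<n∨m≡n n≤1+m
... | inj₁ (s≤s n≤m) = there (there (∣x∣≤m⇒x∈interval m (+ n) n≤m))
... | inj₂ refl      = here refl
∣x∣≤m⇒x∈interval (suc m) -[1+ n ] (s≤s n≤m) with ℕ.m≤n⇒m<n∨m≡n n≤m
... | inj₁ 1+n≤m = there (there (∣x∣≤m⇒x∈interval m -[1+ n ] 1+n≤m))
... | inj₂ refl  = there (here refl)

vanishing : List ℤ → ℤ → ℤ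
vanishing []       x = 1ℤ
vanishing (j ∷ js) x = (x - j) * vanishing js x

vanishing-isPolynomial : ∀ js → IsPolynomial (vanishing js)
vanishing-isPolynomial []       = const-isPolynomial 1ℤ
vanishing-isPolynomial (j ∷ js) = *-isPolynomial (linear-isPolynomial j) (vanishing-isPolynomial js)

vanishing-root : ∀ {js x} → x ∈ js → vanishing js x ≡ 0ℤ
vanishing-root {j ∷ js} {x} (here refl) =
  trans (cong (_* vanishing js x) (+-inverseʳ x)) (*-zeroˡ (vanishing js x))
vanishing-root {j ∷ js} {x} (there x∈js) =
  trans (cong ((x - j) *_) (vanishing-root x∈js)) (*-zeroʳ (x - j))

vanishing≡0⇒root : ∀ js {x} → vanishing js x ≡ 0ℤ → x ∈ js
vanishing≡0⇒root (j ∷ js) {x} v≡0 with i*j≡0⇒i≡0∨j≡0 (x - j) v≡0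
... | inj₁ x-j≡0 = here (i-j≡0⇒i≡j x j x-j≡0)
... | inj₂ v≡0′  = there (vanishing≡0⇒root js v≡0′)

factor : ℕ → ℤ → ℤ
factor m x = 1ℤ + vanishing (interval m) x * vanishing (interval m) x

factor-isPolynomial : ∀ m → IsPolynomial (factor m)
factor-isPolynomial m = +-isPolynomial (const-isPolynomial 1ℤ)
  (*-isPolynomial (vanishing-isPolynomial (interval m)) (vanishing-isPolynomial (interval m)))

factor≢0 : ∀ m x → factor m x ≢ 0ℤ
factor≢0 m x = 1+i*i≢0 (vanishing (interval m) x)

factor-inside : ∀ m x → ∣ x ∣ ≤ m → factor m x ≡ 1ℤ
factor-inside m x ∣x∣≤m rewrite vanishing-root (∣x∣≤m⇒x∈interval m x ∣x∣≤m) = refl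

∣factor∣≡1⇒inside : ∀ m x → ∣ factor m x ∣ ≡ 1 → x ∈ interval m
∣factor∣≡1⇒inside m x ∣h∣≡1 =
  vanishing≡0⇒root (interval m) (∣1+i*i∣≡1⇒i≡0 (vanishing (interval m) x) ∣h∣≡1)

factorsFrom : ℕ → ℕ → ℤ → ℤ
factorsFrom n zero    x = 1ℤ
factorsFrom n (suc k) x = factor n x * factorsFrom (suc n) k x

factorsFrom-isPolynomial : ∀ n k → IsPolynomial (factorsFrom n k)
factorsFrom-isPolynomial n zero    = const-isPolynomial 1ℤ
factorsFrom-isPolynomial n (suc k) = *-isPolynomial (factor-isPolynomial n) (factorsFrom-isPolynomial (suc n) k)

factorsFrom≢0 : ∀ n k x → factorsFrom n k x ≢ 0ℤ
factorsFrom≢0 n (suc k) x p≡0 with i*j≡0⇒i≡0∨j≡0 (factor n x) p≡0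
... | inj₁ h≡0 = factor≢0 n x h≡0
... | inj₂ p≡0′ = factorsFrom≢0 (suc n) k x p≡0′

factorsFrom-inside : ∀ n k x → ∣ x ∣ ≤ n → factorsFrom n k x ≡ 1ℤ
factorsFrom-inside n zero    x _    = refl
factorsFrom-inside n (suc k) x ∣x∣≤n
  rewrite factor-inside n x ∣x∣≤n | factorsFrom-inside (suc n) k x (ℕ.m≤n⇒m≤1+n ∣x∣≤n) = refl

factorsFrom-stable : ∀ n k j x → ∣ x ∣ ≤ n ℕ.+ k → factorsFrom n (k ℕ.+ j) x ≡ factorsFrom n k x
factorsFrom-stable n zero    j x ∣x∣≤n+0 = factorsFrom-inside n j x (subst (∣ x ∣ ≤_) (ℕ.+-identityʳ n) ∣x∣≤n+0)
factorsFrom-stable n (suc k) j x ∣x∣≤n+1+k =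
  cong (factor n x *_) (factorsFrom-stable (suc n) k j x (subst (∣ x ∣ ≤_) (ℕ.+-suc n k) ∣x∣≤n+1+k))

-- tailProduct n x = ∏_{m ≥ n} factor m x: every factor with m ≥ ∣ x ∣ equals 1.
tailProduct : ℕ → ℤ → ℤ
tailProduct n x = factorsFrom n ∣ x ∣ x

factorsFrom≡tailProduct : ∀ n K x → ∣ x ∣ ≤ K → factorsFrom n K x ≡ tailProduct n x
factorsFrom≡tailProduct n K x ∣x∣≤K = begin
  factorsFrom n K x                        ≡⟨ cong (λ k → factorsFrom n k x) (ℕ.m+[n∸m]≡n ∣x∣≤K) ⟨
  factorsFrom n (∣ x ∣ ℕ.+ (K ℕ.∸ ∣ x ∣)) x ≡⟨ factorsFrom-stable n ∣ x ∣ _ x (ℕ.m≤n+m ∣ x ∣ n) ⟩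
  factorsFrom n ∣ x ∣ x                    ∎
  where open ≡-Reasoning

tailProduct-step : ∀ n x → tailProduct n x ≡ factor n x * tailProduct (suc n) x
tailProduct-step n x = begin
  factorsFrom n ∣ x ∣ x           ≡⟨ factorsFrom-stable n ∣ x ∣ 1 x (ℕ.m≤n+m ∣ x ∣ n) ⟨
  factorsFrom n (∣ x ∣ ℕ.+ 1) x   ≡⟨ cong (λ k → factorsFrom n k x) (ℕ.+-comm ∣ x ∣ 1) ⟩
  factorsFrom n (suc ∣ x ∣) x     ∎
  where open ≡-Reasoning

module _ {U : Subset} where

  chain : ℕ → LIP U
  chain n = boundedlyPolynomial⇒LIP (tailProduct n) λ K →
    let p , p≡∏ = factorsFrom-isPolynomial n K in
    p , λ x ∣x∣≤K → trans (p≡∏ x) (factorsFrom≡tailProduct n K x ∣x∣≤K)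

  factorᴸ : ℕ → LIP U
  factorᴸ n = polynomial⇒LIP (factor-isPolynomial n)

  chain-step : ∀ n u → fun (chain n) u ≡ (factorᴸ n · chain (suc n)) u
  chain-step n (x , _) = tailProduct-step n x

  chain-⊆ : ∀ n → chain n ⊆⟨⟩ chain (suc n)
  chain-⊆ n = ∈⟨⟩⇒⊆⟨⟩ {g = chain n} {g' = chain (suc n)} (factorᴸ n , chain-step n)

  chain-⊉ : Infinite U → ∀ n → ¬ (chain (suc n) ⊆⟨⟩ chain n)
  chain-⊉ infinite n chain₁₊ₙ⊆chainₙ with infinite (interval n)
  ... | x , x∈U , x∉[−n,n] = x∉[−n,n] (∣factor∣≡1⇒inside n x
    (⊆⟨⟩⇒cofactor-unit {g = chain n} {g' = chain (suc n)} {k = factorᴸ n}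
      (chain-step n) (λ (y , _) → factorsFrom≢0 (suc n) ∣ y ∣ y) chain₁₊ₙ⊆chainₙ (x , x∈U)))

theorem4 : (U : Subset) → Infinite U →
    ∃ λ (g : ℕ → LIP U) → StrictlyIncreasingPrincipalChain U g
theorem4 U infinite = chain , λ n → chain-⊆ n , chain-⊉ infinite n
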